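{- For any finite simple graph $G$ of order $n\ge1$, $q(G;1)\le 2^{n-1}$, with equality if and only if $G=K_n$.
   Context: The interlace polynomial $q$ is the unique map from finite simple graphs to $\mathbb{Z}[x]$ with $q(E_n)=x^n$ for the edgeless graph $E_n$ on $n$ vertices and $q(G)=q(G-a)+q(G^{ab}-b)$ for every edge $ab$ of $G$; here the pivot $G^{ab}$ is obtained by partitioning the vertices other than $a,b$ into (1) adjacent to $a$ only, (2) adjacent to $b$ only, (3) adjacent to both, (4) adjacent to neither, and toggling the adjacency of every pair $\{x,y\}$ with $x,y$ in two different classes among (1),(2),(3). -}

module Defs where

open import Data.Nat using (ℕ; zero; suc)
open import Data.Bool using (Bool; true; false; not; _∧_; _∨_; _xor_; if_then_else_)
import Data.Bool.Properties as BoolP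
open import Data.Fin using (Fin; punchIn)
open import Data.Fin.Properties using (any?) renaming (_≟_ to _≟ᶠ_)
open import Data.Integer using (ℤ; +_; _+_)
open import Data.List using (List; []; _∷_; replicate; _++_; foldr)
open import Data.Product using (_,_; _×_)
open import Relation.Nullary using (Dec; yes; no; ¬_)
open import Relation.Nullary.Decidable using (⌊_⌋; _×-dec_; ¬?)
open import Relation.Binary.PropositionalEquality using (_≡_)

-- Polynomials in ℤ[x], as coefficient lists (constant term first).

Poly : Set
Poly = List ℤ

infixl 6 _+ₚ_
_+ₚ_ : Poly → Poly → Poly
[]       +ₚ q        = q
(a ∷ p)  +ₚ []       = a ∷ p
(a ∷ p)  +ₚ (b ∷ q)  = (a + b) ∷ (p +ₚ q)

X^ : ℕ → Poly
X^ n = replicate n (+ 0) ++ (+ 1 ∷ [])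

eval1 : Poly → ℤ
eval1 = foldr _+_ (+ 0)

Adj : ℕ → Set
Adj n = Fin n → Fin n → Bool

record SimpleGraph (n : ℕ) : Set where
  field
    adj     : Adj n
    sym     : ∀ i j → adj i j ≡ adj j i
    irrefl  : ∀ i → adj i i ≡ false
open SimpleGraph public

completeAdj : ∀ {n} → Adj n
completeAdj i j = not ⌊ i ≟ᶠ j ⌋

deleteV : ∀ {n} → Fin (suc n) → Adj (suc n) → Adj n
deleteV a G i j = G (punchIn a i) (punchIn a j)

-- the pivot G^{ab}: for x, y ∉ {a,b}, lying in two different classes
-- among (1) adjacent to a only, (2) adjacent to b only, (3) adjacent to both,
-- toggle the adjacency of {x,y}; all other adjacencies are unchanged.
pivot : ∀ {n} → Fin n → Fin n → Adj n → Adj n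
pivot a b G x y = if toggle then not (G x y) else G x y
  where
  outside : Fin _ → Bool
  outside z = not ⌊ z ≟ᶠ a ⌋ ∧ not ⌊ z ≟ᶠ b ⌋
  nbr : Fin _ → Bool          -- in one of the classes (1),(2),(3)
  nbr z = G a z ∨ G b z
  diff : Bool
  diff = (G a x xor G a y) ∨ (G b x xor G b y)
  toggle : Bool
  toggle = outside x ∧ outside y ∧ nbr x ∧ nbr y ∧ diff

edge? : ∀ {n} (G : Adj n) (a b : Fin n) → Dec (¬ (a ≡ b) × G a b ≡ true)
edge? G a b = ¬? (a ≟ᶠ b) ×-dec (G a b BoolP.≟ true)

-- The interlace polynomial, computed by the recursion
-- q(G) = q(G - a) + q(G^{ab} - b) along a (canonically chosen) edge ab,
-- and q(E_n) = x^n when there is no edge.  By the well-definedness of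
-- the interlace polynomial this is the unique such map.
q : ∀ n → Adj n → Poly
q zero G = X^ 0
q (suc n) G with any? (λ a → any? (λ b → edge? G a b))
... | yes (a , b , _) = q n (deleteV a G) +ₚ q n (deleteV b (pivot a b G))
... | no _ = X^ (suc n)

qG : ∀ {n} → SimpleGraph n → Poly
qG {n} G = q n (adj G)

-- Evaluated at x = 1 the recursion reads q(G;1) = q(G-a;1) + q(G^{ab}-b;1), and an edgeless
-- graph gives 1, so by induction q(G;1) ≤ 2^{n-1}. Equality forces both summands to be
-- extremal, i.e. G - a and G^{ab} - b complete. The pivot never changes an adjacency at a,
-- so the second makes a adjacent to every vertex other than b; with the edge ab and G - a
-- complete, G is complete. Conversely, in K_n every other vertex is adjacent to both a
-- and b, so the pivot toggles nothing and both deletions are K_{n-1}.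
module Submission where

open import Defs renaming (sym to adj-sym)
open import Algebra.Bundles using (CommutativeMonoid)
import Algebra.Properties.CommutativeSemigroup as CommSemigroupProperties
open import Data.Bool using (Bool; true; false; not; _∧_; _∨_; _xor_; if_then_else_)
open import Data.Bool.Properties using (∧-commutativeMonoid; ∧-zeroʳ; xor-comm; xor-same)
open import Data.Empty using (⊥-elim)
open import Data.Fin using (Fin; zero; suc; punchIn; punchOut)
open import Data.Fin.Properties using (any?; punchIn-injective; punchIn-punchOut)
  renaming (_≟_ to _≟ᶠ_)
open import Data.Integer using (ℤ; +_; _+_; _≤_; +≤+)
import Data.Integer.Properties as ℤ
open import Data.List using ([]; _∷_)
open import Data.Nat using (ℕ; zero; suc; _^_; s≤s; z≤n)
import Data.Nat as ℕ
import Data.Nat.Properties as ℕ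
open import Data.Product using (_×_; _,_; proj₁; proj₂)
open import Data.Sum using (_⊎_; inj₁; inj₂)
open import Function using (_∘_)
open import Function.Bundles using (_⇔_; mk⇔)
open import Relation.Nullary using (¬_; yes; no; contradiction)
open import Relation.Nullary.Decidable using (⌊_⌋)
open import Relation.Binary.PropositionalEquality
  using (_≡_; _≢_; refl; sym; trans; cong; cong₂; module ≡-Reasoning)

open CommSemigroupProperties (CommutativeMonoid.commutativeSemigroup ∧-commutativeMonoid)
  using () renaming (x∙yz≈y∙xz to ∧-swap)
open CommSemigroupProperties ℤ.+-commutativeSemigroup
  using () renaming (interchange to +-interchange)

private
  variable
    n : ℕ

eval1-homo-+ₚ : ∀ p r → eval1 (p +ₚ r) ≡ eval1 p + eval1 r
eval1-homo-+ₚ []      r       = sym (ℤ.+-identityˡ (eval1 r))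
eval1-homo-+ₚ (a ∷ p) []      = sym (ℤ.+-identityʳ (eval1 (a ∷ p)))
eval1-homo-+ₚ (a ∷ p) (b ∷ r) = begin
  (a + b) + eval1 (p +ₚ r)       ≡⟨ cong (λ s → (a + b) + s) (eval1-homo-+ₚ p r) ⟩
  (a + b) + (eval1 p + eval1 r)  ≡⟨ +-interchange a b (eval1 p) (eval1 r) ⟩
  (a + eval1 p) + (b + eval1 r)  ∎
  where open ≡-Reasoning

eval1-X^ : ∀ k → eval1 (X^ k) ≡ + 1
eval1-X^ zero    = refl
eval1-X^ (suc k) = trans (ℤ.+-identityˡ _) (eval1-X^ k)

+2^-suc : ∀ m → + (2 ^ suc m) ≡ + (2 ^ m) + + (2 ^ m)
+2^-suc m = trans (cong (λ k → + (2 ^ m ℕ.+ k)) (ℕ.+-identityʳ (2 ^ m))) (ℤ.pos-+ (2 ^ m) (2 ^ m))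

1<2^suc : ∀ m → 1 ℕ.< 2 ^ suc m
1<2^suc m = ℕ.^-monoʳ-< 2 (s≤s (s≤s z≤n)) {0} {suc m} (s≤s z≤n)

+-mono-≤-equality : ∀ {a b c d : ℤ} → a ≤ c → b ≤ d → a + b ≡ c + d → a ≡ c × b ≡ d
+-mono-≤-equality a≤c b≤d a+b≡c+d =
  ℤ.≤-antisym a≤c (ℤ.≮⇒≥ (λ a<c → ℤ.<-irrefl a+b≡c+d (ℤ.+-mono-<-≤ a<c b≤d))) ,
  ℤ.≤-antisym b≤d (ℤ.≮⇒≥ (λ b<d → ℤ.<-irrefl a+b≡c+d (ℤ.+-mono-≤-< a≤c b<d)))

Complete : Adj n → Set
Complete G = ∀ i j → G i j ≡ completeAdj i j

Edgeless : Adj n → Set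
Edgeless {n} G = ∀ (a b : Fin n) → a ≢ b → G a b ≢ true

Symmetric : Adj n → Set
Symmetric G = ∀ i j → G i j ≡ G j i

completeAdj-refl : (i : Fin n) → completeAdj i i ≡ false
completeAdj-refl i with i ≟ᶠ i
... | yes _   = refl
... | no i≢i = contradiction refl i≢i

completeAdj-≢ : {i j : Fin n} → i ≢ j → completeAdj i j ≡ true
completeAdj-≢ {i = i} {j} i≢j with i ≟ᶠ j
... | yes i≡j = contradiction i≡j i≢j
... | no _    = refl

completeAdj-sym : Symmetric (completeAdj {n})
completeAdj-sym i j with i ≟ᶠ j | j ≟ᶠ i
... | yes _   | yes _   = refl
... | no _    | no _    = refl
... | yes i≡j | no j≢i = contradiction (sym i≡j) j≢i
... | no i≢j | yes j≡i = contradiction (sym j≡i) i≢j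

completeAdj-punchIn : ∀ (c : Fin (suc n)) i j →
  completeAdj (punchIn c i) (punchIn c j) ≡ completeAdj i j
completeAdj-punchIn c i j with i ≟ᶠ j | punchIn c i ≟ᶠ punchIn c j
... | yes _   | yes _  = refl
... | no _    | no _   = refl
... | yes i≡j | no ne = contradiction (cong (punchIn c) i≡j) ne
... | no i≢j | yes eq = contradiction (punchIn-injective c i j eq) i≢j

complete⇒¬edgeless : {G : Adj (suc (suc n))} → Complete G → ¬ Edgeless G
complete⇒¬edgeless C none = none zero (suc zero) (λ ()) (C zero (suc zero))

deleteV-complete : (c : Fin (suc n)) {G : Adj (suc n)} → Complete G → Complete (deleteV c G)
deleteV-complete c C i j = trans (C (punchIn c i) (punchIn c j)) (completeAdj-punchIn c i j)

complete-off-deleted : (G : Adj (suc n)) {c i j : Fin (suc n)} → Complete (deleteV c G) →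
  c ≢ i → c ≢ j → G i j ≡ completeAdj i j
complete-off-deleted {n} G {c} {i} {j} C c≢i c≢j = begin
  G i j                                     ≡⟨ cong₂ G ↑i′≡i ↑j′≡j ⟨
  G (punchIn c i′) (punchIn c j′)           ≡⟨ C i′ j′ ⟩
  completeAdj i′ j′                         ≡⟨ completeAdj-punchIn c i′ j′ ⟨
  completeAdj (punchIn c i′) (punchIn c j′) ≡⟨ cong₂ completeAdj ↑i′≡i ↑j′≡j ⟩
  completeAdj i j                           ∎
  where
  open ≡-Reasoning
  i′ j′ : Fin n
  i′ = punchOut c≢i
  j′ = punchOut c≢j
  ↑i′≡i : punchIn c i′ ≡ i
  ↑i′≡i = punchIn-punchOut c≢i
  ↑j′≡j : punchIn c j′ ≡ j
  ↑j′≡j = punchIn-punchOut c≢j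

outside : Fin n → Fin n → Fin n → Bool
outside a b z = not ⌊ z ≟ᶠ a ⌋ ∧ not ⌊ z ≟ᶠ b ⌋

-- Definitionally the toggling condition inside `pivot`.
toggles : Fin n → Fin n → Adj n → Fin n → Fin n → Bool
toggles a b G x y = outside a b x ∧ outside a b y ∧ (G a x ∨ G b x) ∧ (G a y ∨ G b y)
                    ∧ ((G a x xor G a y) ∨ (G b x xor G b y))

pivot-unchanged : ∀ (a b : Fin n) (G : Adj n) x y → toggles a b G x y ≡ false →
  pivot a b G x y ≡ G x y
pivot-unchanged a b G x y no-toggle rewrite no-toggle = refl

outside-left : (a b : Fin n) → outside a b a ≡ false
outside-left a b with a ≟ᶠ a
... | yes _   = refl
... | no a≢a = contradiction refl a≢a

outside-right : (a b : Fin n) → outside a b b ≡ false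
outside-right a b with b ≟ᶠ a | b ≟ᶠ b
... | yes _ | _       = refl
... | no _  | yes _   = refl
... | no _  | no b≢b = contradiction refl b≢b

toggles-sym : ∀ a b (G : Adj n) x y → toggles a b G x y ≡ toggles a b G y x
toggles-sym a b G x y = begin
  ox ∧ oy ∧ nx ∧ ny ∧ dxy  ≡⟨ ∧-swap ox oy _ ⟩
  oy ∧ ox ∧ nx ∧ ny ∧ dxy  ≡⟨ cong (λ t → oy ∧ ox ∧ t) (∧-swap nx ny dxy) ⟩
  oy ∧ ox ∧ ny ∧ nx ∧ dxy  ≡⟨ cong (λ t → oy ∧ ox ∧ ny ∧ nx ∧ t)
                                  (cong₂ _∨_ (xor-comm (G a x) (G a y)) (xor-comm (G b x) (G b y))) ⟩
  oy ∧ ox ∧ ny ∧ nx ∧ dyx  ∎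
  where
  open ≡-Reasoning
  ox oy nx ny dxy dyx : Bool
  ox = outside a b x
  oy = outside a b y
  nx = G a x ∨ G b x
  ny = G a y ∨ G b y
  dxy = (G a x xor G a y) ∨ (G b x xor G b y)
  dyx = (G a y xor G a x) ∨ (G b y xor G b x)

toggles-endpoint : ∀ a b (G : Adj n) x y → x ≡ a ⊎ x ≡ b → toggles a b G x y ≡ false
toggles-endpoint a b G .a y (inj₁ refl) rewrite outside-left a b = refl
toggles-endpoint a b G .b y (inj₂ refl) rewrite outside-right a b = refl

toggles-same-class : ∀ a b (G : Adj n) x y → G a x ≡ G a y → G b x ≡ G b y →
  toggles a b G x y ≡ false
toggles-same-class a b G x y ax≡ay bx≡by
  rewrite ax≡ay | bx≡by | xor-same (G a y) | xor-same (G b y)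
        | ∧-zeroʳ (G a y ∨ G b y) | ∧-zeroʳ (G a y ∨ G b y)
        | ∧-zeroʳ (outside a b y) | ∧-zeroʳ (outside a b x) = refl

pivot-fixes-a : ∀ (a b : Fin n) (G : Adj n) y → pivot a b G a y ≡ G a y
pivot-fixes-a a b G y = pivot-unchanged a b G a y (toggles-endpoint a b G a y (inj₁ refl))

pivot-sym : ∀ (a b : Fin n) {G : Adj n} → Symmetric G → Symmetric (pivot a b G)
pivot-sym a b {G} G-sym x y =
  cong₂ (λ t g → if t then not g else g) (toggles-sym a b G x y) (G-sym x y)

pivot-irrefl : ∀ (a b : Fin n) {G : Adj n} → (∀ i → G i i ≡ false) →
  ∀ i → pivot a b G i i ≡ false
pivot-irrefl a b {G} G-irrefl i =
  trans (pivot-unchanged a b G i i (toggles-same-class a b G i i refl refl)) (G-irrefl i)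

endpoint? : (a b x : Fin n) → (x ≡ a ⊎ x ≡ b) ⊎ (x ≢ a × x ≢ b)
endpoint? a b x with x ≟ᶠ a | x ≟ᶠ b
... | yes x≡a | _       = inj₁ (inj₁ x≡a)
... | no _    | yes x≡b = inj₁ (inj₂ x≡b)
... | no x≢a | no x≢b = inj₂ (x≢a , x≢b)

pivot-complete : ∀ (a b : Fin n) {G : Adj n} → Complete G → Complete (pivot a b G)
pivot-complete a b {G} C x y = trans (pivot-unchanged a b G x y no-toggle) (C x y)
  where
  adjacent-to : ∀ {c z} → c ≢ z → G c z ≡ true
  adjacent-to c≢z = trans (C _ _) (completeAdj-≢ c≢z)

  no-toggle : toggles a b G x y ≡ false
  no-toggle with endpoint? a b x | endpoint? a b y
  ... | inj₁ x-end | _ = toggles-endpoint a b G x y x-end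
  ... | _ | inj₁ y-end = trans (toggles-sym a b G x y) (toggles-endpoint a b G y x y-end)
  ... | inj₂ (x≢a , x≢b) | inj₂ (y≢a , y≢b) = toggles-same-class a b G x y
    (trans (adjacent-to (x≢a ∘ sym)) (sym (adjacent-to (y≢a ∘ sym))))
    (trans (adjacent-to (x≢b ∘ sym)) (sym (adjacent-to (y≢b ∘ sym))))

deleteVertex : Fin (suc n) → SimpleGraph (suc n) → SimpleGraph n
deleteVertex c G = record
  { adj    = deleteV c (adj G)
  ; sym    = λ i j → adj-sym G (punchIn c i) (punchIn c j)
  ; irrefl = λ i → irrefl G (punchIn c i)
  }

pivotGraph : Fin n → Fin n → SimpleGraph n → SimpleGraph n
pivotGraph a b G = record
  { adj    = pivot a b (adj G)
  ; sym    = pivot-sym a b (adj-sym G)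
  ; irrefl = pivot-irrefl a b {adj G} (irrefl G)
  }

complete-from-deletions : (G : SimpleGraph (suc n)) {a b : Fin (suc n)} →
  a ≢ b → adj G a b ≡ true →
  Complete (deleteV a (adj G)) → Complete (deleteV b (pivot a b (adj G))) → Complete (adj G)
complete-from-deletions G {a} {b} a≢b ab C-a C-b = complete
  where
  row-a : ∀ j → adj G a j ≡ completeAdj a j
  row-a j with endpoint? a b j
  ... | inj₁ (inj₁ refl) = trans (irrefl G a) (sym (completeAdj-refl a))
  ... | inj₁ (inj₂ refl) = trans ab (sym (completeAdj-≢ a≢b))
  ... | inj₂ (_ , j≢b)   = trans (sym (pivot-fixes-a a b (adj G) j))
                                  (complete-off-deleted (pivot a b (adj G)) C-b (a≢b ∘ sym) (j≢b ∘ sym))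

  complete : Complete (adj G)
  complete i j with i ≟ᶠ a | j ≟ᶠ a
  ... | yes refl | _        = row-a j
  ... | no _    | yes refl = trans (adj-sym G i a) (trans (row-a i) (completeAdj-sym a i))
  ... | no i≢a | no j≢a   = complete-off-deleted (adj G) C-a (i≢a ∘ sym) (j≢a ∘ sym)

-- One unfolding of the recursion defining q; used as `with q n G | step G`.
data Step : ∀ {n} → Adj n → Poly → Set where
  along-edge : ∀ {n} {G : Adj (suc (suc n))} a b → a ≢ b → G a b ≡ true →
    Step G (q (suc n) (deleteV a G) +ₚ q (suc n) (deleteV b (pivot a b G)))
  edgeless : ∀ {n} {G : Adj n} → Edgeless G → Step G (X^ n)

step : (G : Adj n) → Step G (q n G)
step {zero} G = edgeless λ ()
step {suc zero} G with any? (λ a → any? (λ b → edge? G a b))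
... | yes (zero , zero , a≢b , _) = contradiction refl a≢b
... | no none = edgeless λ a b a≢b ab → none (a , b , a≢b , ab)
step {suc (suc n)} G with any? (λ a → any? (λ b → edge? G a b))
... | yes (a , b , a≢b , ab) = along-edge a b a≢b ab
... | no none = edgeless λ a b a≢b ab → none (a , b , a≢b , ab)

q-bound : ∀ n (G : Adj (suc n)) → eval1 (q (suc n) G) ≤ + (2 ^ n)
q-bound n G with q (suc n) G | step G
... | _ | edgeless _ = begin
  eval1 (X^ (suc n))  ≡⟨ eval1-X^ (suc n) ⟩
  + 1                 ≤⟨ +≤+ (ℕ.m^n>0 2 n) ⟩
  + (2 ^ n)           ∎
  where open ℤ.≤-Reasoning
... | _ | along-edge {m} a b _ _ = begin
  eval1 (q (suc m) G₁ +ₚ q (suc m) G₂)        ≡⟨ eval1-homo-+ₚ (q (suc m) G₁) (q (suc m) G₂) ⟩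
  eval1 (q (suc m) G₁) + eval1 (q (suc m) G₂) ≤⟨ ℤ.+-mono-≤ (q-bound m G₁) (q-bound m G₂) ⟩
  + (2 ^ m) + + (2 ^ m)                       ≡⟨ +2^-suc m ⟨
  + (2 ^ suc m)                               ∎
  where
  open ℤ.≤-Reasoning
  G₁ G₂ : Adj (suc m)
  G₁ = deleteV a G
  G₂ = deleteV b (pivot a b G)

q-complete : ∀ n (G : Adj (suc n)) → Complete G → eval1 (q (suc n) G) ≡ + (2 ^ n)
q-complete n G C with q (suc n) G | step G
q-complete zero    G C | _ | edgeless _    = refl
q-complete (suc m) G C | _ | edgeless none = ⊥-elim (complete⇒¬edgeless C none)
q-complete (suc m) G C | _ | along-edge a b _ _ = begin
  eval1 (q (suc m) G₁ +ₚ q (suc m) G₂)        ≡⟨ eval1-homo-+ₚ (q (suc m) G₁) (q (suc m) G₂) ⟩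
  eval1 (q (suc m) G₁) + eval1 (q (suc m) G₂) ≡⟨ cong₂ _+_ (q-complete m G₁ (deleteV-complete a C))
                                                  (q-complete m G₂ (deleteV-complete b (pivot-complete a b C))) ⟩
  + (2 ^ m) + + (2 ^ m)                       ≡⟨ +2^-suc m ⟨
  + (2 ^ suc m)                               ∎
  where
  open ≡-Reasoning
  G₁ G₂ : Adj (suc m)
  G₁ = deleteV a G
  G₂ = deleteV b (pivot a b G)

q-extremal⇒complete : ∀ n (G : SimpleGraph (suc n)) → eval1 (qG G) ≡ + (2 ^ n) → Complete (adj G)
q-extremal⇒complete zero G _ zero zero = irrefl G zero
q-extremal⇒complete (suc m) G extremal with q (suc (suc m)) (adj G) | step (adj G)
... | _ | edgeless _ =
  contradiction (ℤ.+-injective (trans (sym (eval1-X^ (suc (suc m)))) extremal)) (ℕ.<⇒≢ (1<2^suc m))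
... | _ | along-edge a b a≢b ab = complete-from-deletions G a≢b ab
  (q-extremal⇒complete m (deleteVertex a G) (proj₁ halves))
  (q-extremal⇒complete m (deleteVertex b (pivotGraph a b G)) (proj₂ halves))
  where
  G₁ G₂ : Adj (suc m)
  G₁ = deleteV a (adj G)
  G₂ = deleteV b (pivot a b (adj G))
  halves : eval1 (q (suc m) G₁) ≡ + (2 ^ m) × eval1 (q (suc m) G₂) ≡ + (2 ^ m)
  halves = +-mono-≤-equality (q-bound m G₁) (q-bound m G₂)
    (trans (sym (eval1-homo-+ₚ (q (suc m) G₁) (q (suc m) G₂))) (trans extremal (+2^-suc m)))

proposition51 : ∀ (n : ℕ) (G : SimpleGraph (suc n)) →
    (eval1 (qG G) ≤ + (2 ^ n)) ×
    ((eval1 (qG G) ≡ + (2 ^ n)) ⇔ (∀ i j → adj G i j ≡ completeAdj i j))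
proposition51 n G = q-bound n (adj G) , mk⇔ (q-extremal⇒complete n G) (q-complete n (adj G))
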